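{- Fix an integer $d\ge 1$ and a real number $m$, and let $1\le t\le 2d$ be an integer. Let $(\alpha,\beta,\gamma)$ and $(\alpha',\beta',\gamma')$ be two triples of sequences of non-negative reals, $\alpha=(a_i^*)_{0\le i\le d}$, $\beta=(b_i^*)_{0\le i\le d}$, $\gamma=(c_i^*)_{0\le i\le d}$ and similarly $\alpha'=(a_i'^*)$, $\beta'=(b_i'^*)$, $\gamma'=(c_i'^*)$, both satisfying the admissibility conditions below with the same $d$ and $m$, and let $(f_{n,k})$, $(B_n)$ and $(f'_{n,k})$, $(B'_n)$ be their Catalan arrays and Catalan numbers. Then the following are equivalent: (1) $B_i=B'_i$ for all $1\le i\le t$; (2) $f_{n,k}=f'_{n,k}$ for all integers $(n,k)$ with $0\le k\le n$ and $n+k\le t$; (3) $a_i^*=a_i'^*$ for all $0\le i\le \lfloor (t-1)/2\rfloor$ and $c_j^*=c_j'^*$ for all $1\le j\le \lceil (t-1)/2\rceil$. (That is, any one of the three data (1), (2), (3) uniquely determines the other two.)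
   Context: A triple $\alpha=(a_i^*)_{0\le i\le d}$, $\beta=(b_i^*)_{0\le i\le d}$, $\gamma=(c_i^*)_{0\le i\le d}$ of non-negative real sequences is admissible (for $d,m$) if $\prod_{i=0}^{d-1}b_i^*c_{i+1}^*\neq 0$, $a_i^*+b_i^*+c_i^*=m$ for all $0\le i\le d$, $a_0^*=c_0^*=b_d^*=0$ and $c_1^*=1$. Its Catalan array $(f_{n,k})$ is defined for integers $n,k\ge 0$ with $n+k\le 2d$ by $f_{0,0}=1$, $f_{0,k}=0$ for $k\ge1$, and $f_{n,k}=c_k^*f_{n-1,k-1}+a_k^*f_{n-1,k}+b_k^*f_{n-1,k+1}$ for $n\ge1$, where terms with an index out of range are zero (so $f_{n,k}=0$ for $k>n$; note $c_0^*=b_d^*=0$). The Catalan numbers are $B_n=f_{n,0}$ for $0\le n\le 2d$. -}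

module Defs where

open import Level using (0ℓ)
open import Algebra.Bundles using (CommutativeRing)
open import Relation.Binary.Structures using (IsTotalOrder)
open import Relation.Nullary using (¬_; yes; no)
open import Data.Product using (∃; _×_)
open import Data.Nat using (ℕ; zero; suc; _<?_)
open import Data.Fin using (Fin; fromℕ<; fromℕ; inject₁)
  renaming (zero to fzero; suc to fsuc)

-- A model of the real numbers: a complete (Dedekind/least-upper-bound) ordered field.
-- Any two such are isomorphic, so quantifying over all of them is the same as
-- speaking about ℝ.
record RealField : Set₁ where
  field
    commRing : CommutativeRing 0ℓ 0ℓ
  open CommutativeRing commRing public
  field
    _≤ᴿ_ : Carrier → Carrier → Set
    ≤-isTotalOrder : IsTotalOrder _≈_ _≤ᴿ_
    +-mono-≤ : ∀ {x y} z → x ≤ᴿ y → (x + z) ≤ᴿ (y + z)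
    *-nonneg : ∀ {x y} → 0# ≤ᴿ x → 0# ≤ᴿ y → 0# ≤ᴿ (x * y)
    0≉1 : ¬ (0# ≈ 1#)
    inverse : ∀ x → ¬ (x ≈ 0#) → ∃ λ y → (x * y) ≈ 1#
    supremum : (P : Carrier → Set) → ∃ P → (∃ λ u → ∀ x → P x → x ≤ᴿ u) →
               ∃ λ s → (∀ x → P x → x ≤ᴿ s) × (∀ u → (∀ x → P x → x ≤ᴿ u) → s ≤ᴿ u)

module _ (R : RealField) where
  open RealField R

  prod : (n : ℕ) → (Fin n → Carrier) → Carrier
  prod zero    g = 1#
  prod (suc n) g = g fzero * prod n (λ i → g (fsuc i))

  -- entry i of a sequence (s_0,…,s_d); indices out of range give 0
  at : {d : ℕ} → (Fin (suc d) → Carrier) → ℕ → Carrier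
  at {d} s i with i <? suc d
  ... | yes p = s (fromℕ< p)
  ... | no _  = 0#

  record Admissible (d : ℕ) (m : Carrier) (a b c : Fin (suc d) → Carrier) : Set where
    field
      a-nonneg : ∀ i → 0# ≤ᴿ a i
      b-nonneg : ∀ i → 0# ≤ᴿ b i
      c-nonneg : ∀ i → 0# ≤ᴿ c i
      prod-nonzero : ¬ (prod d (λ i → b (inject₁ i) * c (fsuc i)) ≈ 0#)
      row-sum : ∀ i → (a i + b i + c i) ≈ m
      a₀≈0 : at a 0 ≈ 0#
      c₀≈0 : at c 0 ≈ 0#
      b_d≈0 : b (fromℕ d) ≈ 0#
      c₁≈1 : at c 1 ≈ 1#

  -- Catalan array f_{n,k} (defined for all n,k; only n+k ≤ 2d is used)
  catalanArray : {d : ℕ} → (a b c : Fin (suc d) → Carrier) → ℕ → ℕ → Carrier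
  catalanArray a b c zero zero = 1#
  catalanArray a b c zero (suc k) = 0#
  catalanArray a b c (suc n) zero =
    at a 0 * catalanArray a b c n 0 + at b 0 * catalanArray a b c n 1
  catalanArray a b c (suc n) (suc k) =
    at c (suc k) * catalanArray a b c n k
    + at a (suc k) * catalanArray a b c n (suc k)
    + at b (suc k) * catalanArray a b c n (suc (suc k))

  catalanNumber : {d : ℕ} → (a b c : Fin (suc d) → Carrier) → ℕ → Carrier
  catalanNumber a b c n = catalanArray a b c n 0

-- (3) ⇒ (2) is induction along the recurrence: an entry f_{n,k} with n + k ≤ t involves only the
-- a_i with 2i < t and the c_j with 2j ≤ t, together with b_k for 2k + 1 < t, which the row sums
-- a_k + b_k + c_k = m then determine; (2) ⇒ (1) is trivial.  For (1) ⇒ (3) induct on t: once the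
-- data for t are known, climb the antidiagonal n + k = t + 1 from B_{t+1}, solving each
-- recurrence for its b-term (b_k ≠ 0 there since k < d).  At the top,
-- f_{s+1,s} = c_s f_{s,s-1} + a_s f_{s,s}  or  f_{s,s} = c_s f_{s-1,s-1}  yields the one new
-- coefficient, because the diagonal entries f_{s,s} = c_1 ⋯ c_s are nonzero.

module Submission where

open import Defs
open import Data.Nat using (ℕ; suc; _≤_; _+_; _*_; _∸_; ⌊_/2⌋; ⌈_/2⌉)
open import Data.Fin using (Fin)
open import Data.Product using (_×_)
open import Function.Bundles using (_⇔_)

open import Data.Nat using (zero; _<_; z≤n; s≤s; _≤?_; _<?_)
import Data.Nat.Properties as ℕₚ
open ℕₚ
  using ( ≤-refl; ≤-trans; ≤-reflexive; <⇒≤; ≤-pred; n≤1+n; m<n⇒m<1+n; ≰⇒>; +-suc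
        ; suc-injective; +-mono-≤; +-monoˡ-≤; +-monoʳ-≤; m≤n⇒m<n∨m≡n; module ≤-Reasoning
        ; ⌊n/2⌋-mono; ⌊n/2⌋≤⌈n/2⌉; ⌊n/2⌋+⌈n/2⌉≡n; n≡⌊n+n/2⌋ )
open import Data.Fin using (toℕ; fromℕ<; inject₁) renaming (zero to fzero; suc to fsuc)
open import Data.Fin.Properties using (toℕ<n; toℕ-fromℕ<; fromℕ<-toℕ; toℕ-inject₁)
open import Data.Product using (_,_)
open import Data.Sum using (inj₁; inj₂)
open import Data.Empty using (⊥-elim)
open import Relation.Nullary using (¬_; yes; no)
open import Relation.Binary.PropositionalEquality as ≡ using (_≡_)
open import Function.Bundles using (mk⇔)

m+m≤n⇒m≤⌊n/2⌋ : ∀ {m n} → m + m ≤ n → m ≤ ⌊ n /2⌋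
m+m≤n⇒m≤⌊n/2⌋ {m} h = ≡.subst (_≤ _) (≡.sym (n≡⌊n+n/2⌋ m)) (⌊n/2⌋-mono h)

m≤⌊n/2⌋⇒m+m≤n : ∀ {m} n → m ≤ ⌊ n /2⌋ → m + m ≤ n
m≤⌊n/2⌋⇒m+m≤n {m} n h = begin
  m + m               ≤⟨ +-mono-≤ h (≤-trans h (⌊n/2⌋≤⌈n/2⌉ n)) ⟩
  ⌊ n /2⌋ + ⌈ n /2⌉   ≡⟨ ⌊n/2⌋+⌈n/2⌉≡n n ⟩
  n                   ∎
  where open ≤-Reasoning

m+m≤n+n⇒m≤n : ∀ {m n} → m + m ≤ n + n → m ≤ n
m+m≤n+n⇒m≤n {n = n} h = ≡.subst (_ ≤_) (≡.sym (n≡⌊n+n/2⌋ n)) (m+m≤n⇒m≤⌊n/2⌋ h)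

module _ (R : RealField) where
  open RealField R hiding (zero; +-mono-≤) renaming (_+_ to _+ᴿ_; _*_ to _*ᴿ_)
  open import Algebra.Definitions _≈_ using (AlmostLeftCancellative; AlmostRightCancellative)
  open import Algebra.Properties.Ring ring using (+-cancelˡ; +-cancelʳ)
  open import Relation.Binary.Reasoning.Setoid setoid

  *-almostCancelˡ : AlmostLeftCancellative 0# _*ᴿ_
  *-almostCancelˡ x y z x≉0 xy≈xz with inverse x x≉0
  ... | x⁻¹ , xx⁻¹≈1 = begin
    y                ≈⟨ sym (*-identityˡ y) ⟩
    1# *ᴿ y          ≈⟨ *-congʳ (sym x⁻¹x≈1) ⟩
    (x⁻¹ *ᴿ x) *ᴿ y  ≈⟨ *-assoc x⁻¹ x y ⟩
    x⁻¹ *ᴿ (x *ᴿ y)  ≈⟨ *-congˡ xy≈xz ⟩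
    x⁻¹ *ᴿ (x *ᴿ z)  ≈⟨ sym (*-assoc x⁻¹ x z) ⟩
    (x⁻¹ *ᴿ x) *ᴿ z  ≈⟨ *-congʳ x⁻¹x≈1 ⟩
    1# *ᴿ z          ≈⟨ *-identityˡ z ⟩
    z                ∎
    where
      x⁻¹x≈1 : x⁻¹ *ᴿ x ≈ 1#
      x⁻¹x≈1 = trans (*-comm x⁻¹ x) xx⁻¹≈1

  *-almostCancelʳ : AlmostRightCancellative 0# _*ᴿ_
  *-almostCancelʳ x y z x≉0 yx≈zx =
    *-almostCancelˡ x y z x≉0 (trans (*-comm x y) (trans yx≈zx (*-comm z x)))

  x*y≉0⇒x≉0 : ∀ {x y} → ¬ x *ᴿ y ≈ 0# → ¬ x ≈ 0#
  x*y≉0⇒x≉0 {y = y} xy≉0 x≈0 = xy≉0 (trans (*-congʳ x≈0) (zeroˡ y))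

  x*y≉0⇒y≉0 : ∀ {x y} → ¬ x *ᴿ y ≈ 0# → ¬ y ≈ 0#
  x*y≉0⇒y≉0 {x} xy≉0 y≈0 = xy≉0 (trans (*-congˡ y≈0) (zeroʳ x))

  x≉0∧y≉0⇒x*y≉0 : ∀ {x y} → ¬ x ≈ 0# → ¬ y ≈ 0# → ¬ x *ᴿ y ≈ 0#
  x≉0∧y≉0⇒x*y≉0 {x} {y} x≉0 y≉0 xy≈0 = y≉0 (*-almostCancelˡ x y 0# x≉0 (trans xy≈0 (sym (zeroʳ x))))

  prod≉0⇒factor≉0 : ∀ {n} (g : Fin n → Carrier) → ¬ prod R n g ≈ 0# → ∀ i → ¬ g i ≈ 0#
  prod≉0⇒factor≉0 g ∏≉0 fzero    = x*y≉0⇒x≉0 ∏≉0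
  prod≉0⇒factor≉0 g ∏≉0 (fsuc i) = prod≉0⇒factor≉0 (λ j → g (fsuc j)) (x*y≉0⇒y≉0 ∏≉0) i

  at-toℕ : ∀ {d} (s : Fin (suc d) → Carrier) (i : Fin (suc d)) → at R s (toℕ i) ≡ s i
  at-toℕ {d} s i with toℕ i <? suc d
  ... | yes i<1+d = ≡.cong s (fromℕ<-toℕ i i<1+d)
  ... | no  i≮1+d = ⊥-elim (i≮1+d (toℕ<n i))

  module CatalanArray {d} (a b c : Fin (suc d) → Carrier) where
    f : ℕ → ℕ → Carrier
    f = catalanArray R a b c

    catalanArray-above-diagonal : ∀ {n k} → n < k → f n k ≈ 0#
    catalanArray-above-diagonal {zero}  {suc k} _         = refl
    catalanArray-above-diagonal {suc n} {suc k} (s≤s n<k) = begin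
      at R c (suc k) *ᴿ f n k +ᴿ at R a (suc k) *ᴿ f n (suc k) +ᴿ at R b (suc k) *ᴿ f n (suc (suc k))
        ≈⟨ +-cong (+-cong (vanish n<k) (vanish (m<n⇒m<1+n n<k))) (vanish (m<n⇒m<1+n (m<n⇒m<1+n n<k))) ⟩
      0# +ᴿ 0# +ᴿ 0#   ≈⟨ trans (+-identityʳ _) (+-identityʳ 0#) ⟩
      0#               ∎
      where
        vanish : ∀ {x j} → n < j → x *ᴿ f n j ≈ 0#
        vanish {x} n<j = trans (*-congˡ (catalanArray-above-diagonal n<j)) (zeroʳ x)

    private
      drop-vanishing : ∀ {x y n j} → n < j → x +ᴿ y *ᴿ f n j ≈ x
      drop-vanishing {x} {y} n<j =
        trans (+-congˡ (trans (*-congˡ (catalanArray-above-diagonal n<j)) (zeroʳ y))) (+-identityʳ x)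

    catalanArray-diagonal : ∀ s → f (suc s) (suc s) ≈ at R c (suc s) *ᴿ f s s
    catalanArray-diagonal s =
      trans (drop-vanishing (n≤1+n (suc s))) (drop-vanishing (≤-refl {suc s}))

    catalanArray-subdiagonal : ∀ s →
      f (suc (suc s)) (suc s) ≈ at R c (suc s) *ᴿ f (suc s) s +ᴿ at R a (suc s) *ᴿ f (suc s) (suc s)
    catalanArray-subdiagonal s = drop-vanishing (≤-refl {suc (suc s)})

    -- Reading f n k as weighted lattice paths, c weights up steps, a level steps and b down steps;
    -- these are the terms of f (suc n) k whose last step is not a down step.
    upAndLevelTerms : ℕ → ℕ → Carrier
    upAndLevelTerms n zero    = at R a 0 *ᴿ f n 0
    upAndLevelTerms n (suc k) = at R c (suc k) *ᴿ f n k +ᴿ at R a (suc k) *ᴿ f n (suc k)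

    catalanArray-suc : ∀ n k → f (suc n) k ≈ upAndLevelTerms n k +ᴿ at R b k *ᴿ f n (suc k)
    catalanArray-suc n zero    = refl
    catalanArray-suc n (suc k) = refl

  module AdmissibleProperties {d m a b c} (adm : Admissible R d m a b c) where
    open Admissible adm
    open CatalanArray a b c

    private
      b≉0 : ∀ (i : Fin d) → ¬ b (inject₁ i) ≈ 0#
      b≉0 i = x*y≉0⇒x≉0 (prod≉0⇒factor≉0 _ prod-nonzero i)

      c≉0 : ∀ (i : Fin d) → ¬ c (fsuc i) ≈ 0#
      c≉0 i = x*y≉0⇒y≉0 (prod≉0⇒factor≉0 _ prod-nonzero i)

    at-b≉0 : ∀ {k} → k < d → ¬ at R b k ≈ 0#
    at-b≉0 k<d bₖ≈0 = b≉0 i (trans (reflexive (≡.sym (at-toℕ b (inject₁ i)))) bₖ≈0′)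
      where
        i : Fin d
        i = fromℕ< k<d
        bₖ≈0′ : at R b (toℕ (inject₁ i)) ≈ 0#
        bₖ≈0′ = ≡.subst (λ j → at R b j ≈ 0#) (≡.sym (≡.trans (toℕ-inject₁ i) (toℕ-fromℕ< k<d))) bₖ≈0

    at-c≉0 : ∀ {k} → k < d → ¬ at R c (suc k) ≈ 0#
    at-c≉0 k<d cₖ≈0 = c≉0 i (trans (reflexive (≡.sym (at-toℕ c (fsuc i)))) cₖ≈0′)
      where
        i : Fin d
        i = fromℕ< k<d
        cₖ≈0′ : at R c (suc (toℕ i)) ≈ 0#
        cₖ≈0′ = ≡.subst (λ j → at R c (suc j) ≈ 0#) (≡.sym (toℕ-fromℕ< k<d)) cₖ≈0

    diagonal≉0 : ∀ {s} → s ≤ d → ¬ f s s ≈ 0#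
    diagonal≉0 {zero}  _   f₀₀≈0 = 0≉1 (sym f₀₀≈0)
    diagonal≉0 {suc s} s<d fₛₛ≈0 =
      x≉0∧y≉0⇒x*y≉0 (at-c≉0 s<d) (diagonal≉0 (<⇒≤ s<d)) (trans (sym (catalanArray-diagonal s)) fₛₛ≈0)

  module Comparison {d m a b c a′ b′ c′}
                    (adm : Admissible R d m a b c) (adm′ : Admissible R d m a′ b′ c′) where
    open CatalanArray a b c
    open CatalanArray a′ b′ c′ using () renaming
      ( f to f′; upAndLevelTerms to upAndLevelTerms′
      ; catalanArray-above-diagonal to catalanArray′-above-diagonal
      ; catalanArray-diagonal to catalanArray′-diagonal
      ; catalanArray-subdiagonal to catalanArray′-subdiagonal
      ; catalanArray-suc to catalanArray′-suc )
    open AdmissibleProperties adm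
    open Admissible using (a₀≈0; c₀≈0; row-sum)

    a₀-agree : at R a 0 ≈ at R a′ 0
    a₀-agree = trans (a₀≈0 adm) (sym (a₀≈0 adm′))

    c₀-agree : at R c 0 ≈ at R c′ 0
    c₀-agree = trans (c₀≈0 adm) (sym (c₀≈0 adm′))

    b-agree : ∀ {k} → at R a k ≈ at R a′ k → at R c k ≈ at R c′ k → at R b k ≈ at R b′ k
    b-agree {k} aₖ cₖ with k <? suc d
    ... | no  _      = refl
    ... | yes k<1+d = +-cancelˡ (a′ i) (b i) (b′ i) (+-cancelʳ (c′ i) _ _ (begin
      a′ i +ᴿ b i +ᴿ c′ i    ≈⟨ +-cong (+-congʳ (sym aₖ)) (sym cₖ) ⟩
      a i +ᴿ b i +ᴿ c i      ≈⟨ trans (row-sum adm i) (sym (row-sum adm′ i)) ⟩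
      a′ i +ᴿ b′ i +ᴿ c′ i   ∎))
      where
        i : Fin (suc d)
        i = fromℕ< k<1+d

    record CoefficientsAgree (t : ℕ) : Set where
      field
        a-agree : ∀ i → suc (i + i) ≤ t → at R a i ≈ at R a′ i
        c-agree : ∀ j → j + j ≤ t → at R c j ≈ at R c′ j

    ArraysAgree : ℕ → Set
    ArraysAgree t = ∀ n k → n + k ≤ t → f n k ≈ f′ n k

    -- Above the diagonal both arrays vanish, so there the weights need not agree.
    weighted-agree : ∀ {x x′ n k} → (k ≤ n → x ≈ x′) → (k ≤ n → f n k ≈ f′ n k) →
                     x *ᴿ f n k ≈ x′ *ᴿ f′ n k
    weighted-agree {x} {x′} {n} {k} x≈x′ f≈f′ with k ≤? n
    ... | yes k≤n = *-cong (x≈x′ k≤n) (f≈f′ k≤n)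
    ... | no  k≰n = begin
      x *ᴿ f n k     ≈⟨ *-congˡ (catalanArray-above-diagonal (≰⇒> k≰n)) ⟩
      x *ᴿ 0#        ≈⟨ trans (zeroʳ x) (sym (zeroʳ x′)) ⟩
      x′ *ᴿ 0#       ≈⟨ *-congˡ (sym (catalanArray′-above-diagonal (≰⇒> k≰n))) ⟩
      x′ *ᴿ f′ n k   ∎

    upAndLevel-agree : ∀ {n k} → (k ≤ suc n → at R c k ≈ at R c′ k) → (k ≤ n → at R a k ≈ at R a′ k) →
                       (∀ j → j ≤ k → f n j ≈ f′ n j) → upAndLevelTerms n k ≈ upAndLevelTerms′ n k
    upAndLevel-agree {k = zero}  _  aₖ fₙ = *-cong (aₖ z≤n) (fₙ 0 z≤n)
    upAndLevel-agree {k = suc k} cₖ aₖ fₙ =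
      +-cong (weighted-agree (λ k≤n → cₖ (s≤s k≤n)) (λ _ → fₙ k (n≤1+n k)))
             (weighted-agree aₖ (λ _ → fₙ (suc k) ≤-refl))

    arrays-agree : ∀ {t} → CoefficientsAgree t → ArraysAgree t
    arrays-agree ca zero    zero    _ = refl
    arrays-agree ca zero    (suc k) _ = refl
    arrays-agree {t} ca (suc n) k 1+n+k≤t = begin
      f (suc n) k                                       ≈⟨ catalanArray-suc n k ⟩
      upAndLevelTerms n k +ᴿ at R b k *ᴿ f n (suc k)    ≈⟨ +-cong (upAndLevel-agree cₖ aₖ fₙ) bₖfₙ ⟩
      upAndLevelTerms′ n k +ᴿ at R b′ k *ᴿ f′ n (suc k) ≈⟨ sym (catalanArray′-suc n k) ⟩
      f′ (suc n) k                                      ∎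
      where
        open CoefficientsAgree ca
        cₖ : k ≤ suc n → at R c k ≈ at R c′ k
        cₖ k≤1+n = c-agree k (≤-trans (+-monoˡ-≤ k k≤1+n) 1+n+k≤t)
        aₖ : k ≤ n → at R a k ≈ at R a′ k
        aₖ k≤n = a-agree k (≤-trans (s≤s (+-monoˡ-≤ k k≤n)) 1+n+k≤t)
        fₙ : ∀ j → j ≤ k → f n j ≈ f′ n j
        fₙ j j≤k = arrays-agree ca n j (≤-trans (+-monoʳ-≤ n j≤k) (<⇒≤ 1+n+k≤t))
        bₖfₙ : at R b k *ᴿ f n (suc k) ≈ at R b′ k *ᴿ f′ n (suc k)
        bₖfₙ = weighted-agree (λ k<n → b-agree {k} (aₖ (<⇒≤ k<n)) (cₖ (≤-trans (<⇒≤ k<n) (n≤1+n n))))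
                              (λ _ → arrays-agree ca n (suc k) (≡.subst (_≤ t) (≡.sym (+-suc n k)) 1+n+k≤t))

    down-term-agree : ∀ {n k} → at R b k ≈ at R b′ k → ¬ at R b k ≈ 0# →
                      upAndLevelTerms n k ≈ upAndLevelTerms′ n k → f (suc n) k ≈ f′ (suc n) k →
                      f n (suc k) ≈ f′ n (suc k)
    down-term-agree {n} {k} bₖ bₖ≉0 u≈u′ f≈f′ =
      *-almostCancelˡ (at R b k) _ _ bₖ≉0 (+-cancelˡ (upAndLevelTerms n k) _ _ (begin
        upAndLevelTerms n k +ᴿ at R b k *ᴿ f n (suc k)    ≈⟨ sym (catalanArray-suc n k) ⟩
        f (suc n) k                                       ≈⟨ f≈f′ ⟩
        f′ (suc n) k                                      ≈⟨ catalanArray′-suc n k ⟩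
        upAndLevelTerms′ n k +ᴿ at R b′ k *ᴿ f′ n (suc k) ≈⟨ +-cong (sym u≈u′) (*-congʳ (sym bₖ)) ⟩
        upAndLevelTerms n k +ᴿ at R b k *ᴿ f′ n (suc k)   ∎))

    -- Walk up the antidiagonal n + k = t + 1 from f (t + 1) 0, solving each recurrence for its
    -- down-step term; this stays inside the range where b is invertible.
    antidiagonal-agree : ∀ {t} → CoefficientsAgree t → ArraysAgree t → suc t ≤ d + d →
                         f (suc t) 0 ≈ f′ (suc t) 0 →
                         ∀ k n → n + k ≡ suc t → k + k ≤ suc t → f n k ≈ f′ n k
    antidiagonal-agree _ _ _ B≈B′ zero n n+0≡1+t _ =
      ≡.subst (λ x → f x 0 ≈ f′ x 0) (≡.sym (≡.trans (≡.sym (ℕₚ.+-identityʳ n)) n+0≡1+t)) B≈B′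
    antidiagonal-agree {t} ca arrays 1+t≤2d B≈B′ (suc k) n n+1+k≡1+t 2k+2≤1+t =
      down-term-agree {n} {k} (b-agree {k} aₖ cₖ) (at-b≉0 (m+m≤n+n⇒m≤n (≤-trans 2k+2≤1+t 1+t≤2d)))
        (upAndLevel-agree {n} {k} (λ _ → cₖ) (λ _ → aₖ)
          (λ j j≤k → arrays n j (≤-trans (+-monoʳ-≤ n j≤k) (≤-reflexive n+k≡t))))
        (antidiagonal-agree ca arrays 1+t≤2d B≈B′ k (suc n) 1+n+k≡1+t
          (≤-trans (+-mono-≤ (n≤1+n k) (n≤1+n k)) 2k+2≤1+t))
      where
        open CoefficientsAgree ca
        1+n+k≡1+t : suc n + k ≡ suc t
        1+n+k≡1+t = ≡.trans (≡.sym (+-suc n k)) n+1+k≡1+t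
        n+k≡t : n + k ≡ t
        n+k≡t = suc-injective 1+n+k≡1+t
        2k+1≤t : suc (k + k) ≤ t
        2k+1≤t = ≤-pred (≡.subst (_≤ suc t) (≡.cong suc (+-suc k k)) 2k+2≤1+t)
        aₖ : at R a k ≈ at R a′ k
        aₖ = a-agree k 2k+1≤t
        cₖ : at R c k ≈ at R c′ k
        cₖ = c-agree k (<⇒≤ 2k+1≤t)

    a-agree-from-subdiagonal : ∀ s → at R c (suc s) ≈ at R c′ (suc s) →
      f (suc s) s ≈ f′ (suc s) s → f (suc s) (suc s) ≈ f′ (suc s) (suc s) →
      ¬ f (suc s) (suc s) ≈ 0# → f (suc (suc s)) (suc s) ≈ f′ (suc (suc s)) (suc s) →
      at R a (suc s) ≈ at R a′ (suc s)
    a-agree-from-subdiagonal s cₛ f≈f′ g≈g′ g≉0 h≈h′ =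
      *-almostCancelʳ (f (suc s) (suc s)) _ _ g≉0 (+-cancelˡ (at R c (suc s) *ᴿ f (suc s) s) _ _ (begin
        at R c (suc s) *ᴿ f (suc s) s +ᴿ at R a (suc s) *ᴿ f (suc s) (suc s)
          ≈⟨ sym (catalanArray-subdiagonal s) ⟩
        f (suc (suc s)) (suc s)
          ≈⟨ h≈h′ ⟩
        f′ (suc (suc s)) (suc s)
          ≈⟨ catalanArray′-subdiagonal s ⟩
        at R c′ (suc s) *ᴿ f′ (suc s) s +ᴿ at R a′ (suc s) *ᴿ f′ (suc s) (suc s)
          ≈⟨ +-cong (*-cong (sym cₛ) (sym f≈f′)) (*-congˡ (sym g≈g′)) ⟩
        at R c (suc s) *ᴿ f (suc s) s +ᴿ at R a′ (suc s) *ᴿ f (suc s) (suc s) ∎))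

    c-agree-from-diagonal : ∀ s → f s s ≈ f′ s s → ¬ f s s ≈ 0# →
      f (suc s) (suc s) ≈ f′ (suc s) (suc s) → at R c (suc s) ≈ at R c′ (suc s)
    c-agree-from-diagonal s f≈f′ f≉0 g≈g′ = *-almostCancelʳ (f s s) _ _ f≉0 (begin
      at R c (suc s) *ᴿ f s s     ≈⟨ sym (catalanArray-diagonal s) ⟩
      f (suc s) (suc s)           ≈⟨ g≈g′ ⟩
      f′ (suc s) (suc s)          ≈⟨ catalanArray′-diagonal s ⟩
      at R c′ (suc s) *ᴿ f′ s s   ≈⟨ *-congˡ (sym f≈f′) ⟩
      at R c′ (suc s) *ᴿ f s s    ∎)

    coefficients-agree-suc : ∀ {t} → CoefficientsAgree t → suc t ≤ d + d →
                             f (suc t) 0 ≈ f′ (suc t) 0 → CoefficientsAgree (suc t)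
    coefficients-agree-suc {t} ca 1+t≤2d B≈B′ = record { a-agree = a-agree′ ; c-agree = c-agree′ }
      where
        open CoefficientsAgree ca
        arrays : ArraysAgree t
        arrays = arrays-agree ca
        antidiagonal : ∀ k n → n + k ≡ suc t → k + k ≤ suc t → f n k ≈ f′ n k
        antidiagonal = antidiagonal-agree ca arrays 1+t≤2d B≈B′

        diagonal≉0′ : ∀ s → s + s ≤ suc t → ¬ f s s ≈ 0#
        diagonal≉0′ s 2s≤1+t = diagonal≉0 {s} (m+m≤n+n⇒m≤n (≤-trans 2s≤1+t 1+t≤2d))

        new-a : ∀ i → i + i ≡ t → at R a i ≈ at R a′ i
        new-a zero    _     = a₀-agree
        new-a (suc s) 2s≡t  = a-agree-from-subdiagonal s
          (c-agree (suc s) (≤-reflexive 2s≡t))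
          (arrays (suc s) s (≤-trans (+-monoʳ-≤ (suc s) (n≤1+n s)) (≤-reflexive 2s≡t)))
          (arrays (suc s) (suc s) (≤-reflexive 2s≡t))
          (diagonal≉0′ (suc s) (≤-trans (≤-reflexive 2s≡t) (n≤1+n t)))
          (antidiagonal (suc s) (suc (suc s)) (≡.cong suc 2s≡t) (≤-trans (≤-reflexive 2s≡t) (n≤1+n t)))

        new-c : ∀ j → j + j ≡ suc t → at R c j ≈ at R c′ j
        new-c zero    ()
        new-c (suc s) 2s≡1+t = c-agree-from-diagonal s
          (arrays s s 2s≤t)
          (diagonal≉0′ s (≤-trans 2s≤t (n≤1+n t)))
          (antidiagonal (suc s) (suc s) 2s≡1+t (≤-reflexive 2s≡1+t))
          where
            2s≤t : s + s ≤ t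
            2s≤t = ≤-trans (+-monoʳ-≤ s (n≤1+n s)) (≤-reflexive (suc-injective 2s≡1+t))

        a-agree′ : ∀ i → suc (i + i) ≤ suc t → at R a i ≈ at R a′ i
        a-agree′ i 2i+1≤1+t with m≤n⇒m<n∨m≡n 2i+1≤1+t
        ... | inj₁ 2i+1<1+t = a-agree i (≤-pred 2i+1<1+t)
        ... | inj₂ 2i+1≡1+t = new-a i (suc-injective 2i+1≡1+t)

        c-agree′ : ∀ j → j + j ≤ suc t → at R c j ≈ at R c′ j
        c-agree′ j 2j≤1+t with m≤n⇒m<n∨m≡n 2j≤1+t
        ... | inj₁ 2j<1+t = c-agree j (≤-pred 2j<1+t)
        ... | inj₂ 2j≡1+t = new-c j 2j≡1+t

    coefficients-agree : ∀ {t} → t ≤ d + d → (∀ n → 1 ≤ n → n ≤ t → f n 0 ≈ f′ n 0) →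
                         CoefficientsAgree t
    coefficients-agree {zero} _ _ = record
      { a-agree = λ _ ()
      ; c-agree = λ { zero _ → c₀-agree ; (suc _) () }
      }
    coefficients-agree {suc t} 1+t≤2d B≈B′ = coefficients-agree-suc
      (coefficients-agree (≤-trans (n≤1+n t) 1+t≤2d) (λ n 1≤n n≤t → B≈B′ n 1≤n (≤-trans n≤t (n≤1+n t))))
      1+t≤2d (B≈B′ (suc t) (s≤s z≤n) ≤-refl)

    coefficients-agree⇒halves : ∀ {t} → CoefficientsAgree (suc t) →
      (∀ i → i ≤ ⌊ t /2⌋ → at R a i ≈ at R a′ i) × (∀ j → 1 ≤ j → j ≤ ⌈ t /2⌉ → at R c j ≈ at R c′ j)
    coefficients-agree⇒halves {t} ca =
        (λ i i≤⌊t/2⌋ → a-agree i (s≤s (m≤⌊n/2⌋⇒m+m≤n t i≤⌊t/2⌋)))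
      , (λ j _ j≤⌈t/2⌉ → c-agree j (m≤⌊n/2⌋⇒m+m≤n (suc t) j≤⌈t/2⌉))
      where open CoefficientsAgree ca

    halves⇒coefficients-agree : ∀ {t} →
      (∀ i → i ≤ ⌊ t /2⌋ → at R a i ≈ at R a′ i) × (∀ j → 1 ≤ j → j ≤ ⌈ t /2⌉ → at R c j ≈ at R c′ j) →
      CoefficientsAgree (suc t)
    halves⇒coefficients-agree (aᵢ , cⱼ) = record
      { a-agree = λ i 2i+1≤1+t → aᵢ i (m+m≤n⇒m≤⌊n/2⌋ (≤-pred 2i+1≤1+t))
      ; c-agree = λ { zero _ → c₀-agree ; (suc j) 2j≤1+t → cⱼ (suc j) (s≤s z≤n) (m+m≤n⇒m≤⌊n/2⌋ 2j≤1+t) }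
      }

proposition2p2 : (R : RealField) → let open RealField R using (Carrier) renaming (_≈_ to _≈ᴿ_) in
    (d : ℕ) → 1 ≤ d → (m : Carrier) → (t : ℕ) → 1 ≤ t → t ≤ 2 * d →
    (a b c a′ b′ c′ : Fin (suc d) → Carrier) →
    Admissible R d m a b c → Admissible R d m a′ b′ c′ →
    let f  = catalanArray R a b c
        f′ = catalanArray R a′ b′ c′
        B  = catalanNumber R a b c
        B′ = catalanNumber R a′ b′ c′
        S1 = ∀ i → 1 ≤ i → i ≤ t → B i ≈ᴿ B′ i
        S2 = ∀ n k → k ≤ n → n + k ≤ t → f n k ≈ᴿ f′ n k
        S3 = (∀ i → i ≤ ⌊ t ∸ 1 /2⌋ → at R a i ≈ᴿ at R a′ i)
             × (∀ j → 1 ≤ j → j ≤ ⌈ t ∸ 1 /2⌉ → at R c j ≈ᴿ at R c′ j)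
    in (S1 ⇔ S2) × (S2 ⇔ S3)
proposition2p2 R d _ m (suc t) _ 1+t≤2*d a b c a′ b′ c′ adm adm′ =
    mk⇔ (λ S1 n k _ → arrays-agree (coefficients-agree 1+t≤d+d S1) n k)
        (λ S2 i _ i≤1+t → S2 i 0 z≤n (i+0≤1+t i≤1+t))
  , mk⇔ (λ S2 → coefficients-agree⇒halves
                  (coefficients-agree 1+t≤d+d (λ i _ i≤1+t → S2 i 0 z≤n (i+0≤1+t i≤1+t))))
        (λ S3 n k _ → arrays-agree (halves⇒coefficients-agree S3) n k)
  where
    open Comparison R adm adm′
    1+t≤d+d : suc t ≤ d + d
    1+t≤d+d = ≤-trans 1+t≤2*d (≤-reflexive (≡.cong (d +_) (ℕₚ.+-identityʳ d)))
    i+0≤1+t : ∀ {i} → i ≤ suc t → i + 0 ≤ suc t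
    i+0≤1+t = ≡.subst (_≤ suc t) (≡.sym (ℕₚ.+-identityʳ _))
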